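{- Enumerate $\Sigma=\{\mathtt{a}_1,\mathtt{a}_2,\dots\}$ and $\Pi=\{\mathtt{p}_1,\mathtt{p}_2,\dots\}$ without repetitions. For $e\in\mathbb{E}$ let $e'$ be the expression obtained from $e$ by replacing every occurrence of $\mathtt{a}_n$ by $\mathtt{a}_{2n}$ and every occurrence of $\mathtt{p}_n$ by $(\mathtt{a}_{2n+1})^{\top}$. Then for all $e,f\in\mathbb{E}$: $e\equiv f\iff e'\equiv f'$.
   Context: Fix disjoint countably infinite sets $\Sigma$ (actions) and $\Pi$ (propositional letters). The set $\mathbb{E}$ of expressions is generated by $e,f::=\mathtt{a}\in\Sigma\mid \mathtt{p}\in\Pi\mid \mathtt{0}\mid\mathtt{1}\mid e+f\mid e\cdot f\mid e^{\bot}\mid e^{\top}\mid e^{*}$. The relation $\equiv$ is the smallest congruence on $\mathbb{E}$ (w.r.t. all operations) such that, writing $e\leqq f$ for $e+f\equiv f$, for all $e,f,g\in\mathbb{E}$, $\mathtt{p}\in\Pi$: $+$ is associative, commutative, idempotent with identity $\mathtt{0}$; $\cdot$ is associative with identity $\mathtt{1}$; $\mathtt{0}\cdot e\equiv\mathtt{0}\equiv e\cdot\mathtt{0}$; $\cdot$ distributes over $+$ on both sides; $\mathtt{1}+e\cdot e^*\leqq e^*$; $\mathtt{1}+e^*\cdot e\leqq e^*$; if $f+e\cdot g\leqq g$ then $e^*\cdot f\leqq g$; if $f+g\cdot e\leqq g$ then $f\cdot e^*\leqq g$; and $e^{\bot}\cdot e\equiv\mathtt{0}$, $(e\cdot f)^{\bot}\equiv(e\cdot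 f^{\top})^{\bot}$, $e^{\bot}+e^{\top}\equiv\mathtt{1}$, $\mathtt{p}^{\top}\equiv\mathtt{p}$, $e^{\top}\equiv(e^{\bot})^{\bot}$. -}

module Defs where

open import Data.Nat using (ℕ; zero; suc; _+_; _*_)

-- Σ = { a₁, a₂, ... } and Π = { p₁, p₂, ... } enumerated without repetition:
-- the constructor  act n  denotes a_(n+1)  and  prop n  denotes p_(n+1)
-- (i.e. the argument is the 0-based position in the enumeration).
infixl 6 _⊕_
infixl 7 _⊙_
data E : Set where
  act  : ℕ → E
  prop : ℕ → E
  𝟘 𝟙  : E
  _⊕_ _⊙_ : E → E → E
  _⊥ _⊤ _⋆ : E → E


infix 4 _≡ₑ_ _≦_

data _≡ₑ_ : E → E → Set

_≦_ : E → E → Set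
e ≦ f = (e ⊕ f) ≡ₑ f

data _≡ₑ_ where
  refl≡ : ∀ {e} → e ≡ₑ e
  sym≡ : ∀ {e f} → e ≡ₑ f → f ≡ₑ e
  trans≡ : ∀ {e f g} → e ≡ₑ f → f ≡ₑ g → e ≡ₑ g
  cong⊕ : ∀ {e e' f f'} → e ≡ₑ e' → f ≡ₑ f' → (e ⊕ f) ≡ₑ (e' ⊕ f')
  cong⊙ : ∀ {e e' f f'} → e ≡ₑ e' → f ≡ₑ f' → (e ⊙ f) ≡ₑ (e' ⊙ f')
  cong⊥ : ∀ {e e'} → e ≡ₑ e' → (e ⊥) ≡ₑ (e' ⊥)
  cong⊤ : ∀ {e e'} → e ≡ₑ e' → (e ⊤) ≡ₑ (e' ⊤)
  cong⋆ : ∀ {e e'} → e ≡ₑ e' → (e ⋆) ≡ₑ (e' ⋆)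
  ⊕-assoc : ∀ {e f g} → (e ⊕ (f ⊕ g)) ≡ₑ ((e ⊕ f) ⊕ g)
  ⊕-comm : ∀ {e f} → (e ⊕ f) ≡ₑ (f ⊕ e)
  ⊕-idem : ∀ {e} → (e ⊕ e) ≡ₑ e
  ⊕-idʳ : ∀ {e} → (e ⊕ 𝟘) ≡ₑ e
  ⊙-assoc : ∀ {e f g} → (e ⊙ (f ⊙ g)) ≡ₑ ((e ⊙ f) ⊙ g)
  ⊙-idˡ : ∀ {e} → (𝟙 ⊙ e) ≡ₑ e
  ⊙-idʳ : ∀ {e} → (e ⊙ 𝟙) ≡ₑ e
  ⊙-zeroˡ : ∀ {e} → (𝟘 ⊙ e) ≡ₑ 𝟘
  ⊙-zeroʳ : ∀ {e} → (e ⊙ 𝟘) ≡ₑ 𝟘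
  distribˡ : ∀ {e f g} → (e ⊙ (f ⊕ g)) ≡ₑ ((e ⊙ f) ⊕ (e ⊙ g))
  distribʳ : ∀ {e f g} → ((e ⊕ f) ⊙ g) ≡ₑ ((e ⊙ g) ⊕ (f ⊙ g))
  star-unfoldˡ : ∀ {e} → (𝟙 ⊕ (e ⊙ (e ⋆))) ≦ (e ⋆)
  star-unfoldʳ : ∀ {e} → (𝟙 ⊕ ((e ⋆) ⊙ e)) ≦ (e ⋆)
  star-indˡ : ∀ {e f g} → (f ⊕ (e ⊙ g)) ≦ g → ((e ⋆) ⊙ f) ≦ g
  star-indʳ : ∀ {e f g} → (f ⊕ (g ⊙ e)) ≦ g → (f ⊙ (e ⋆)) ≦ g
  ⊥-ann : ∀ {e} → ((e ⊥) ⊙ e) ≡ₑ 𝟘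
  ⊥-loc : ∀ {e f} → ((e ⊙ f) ⊥) ≡ₑ ((e ⊙ (f ⊤)) ⊥)
  ⊥⊤-compl : ∀ {e} → ((e ⊥) ⊕ (e ⊤)) ≡ₑ 𝟙
  prop-⊤ : ∀ {n} → (prop n ⊤) ≡ₑ prop n
  ⊤-def : ∀ {e} → (e ⊤) ≡ₑ ((e ⊥) ⊥)

-- In the 0-based constructor encoding (act k = a_(k+1), prop k = p_(k+1)):
--   act k  = a_(k+1) ↦ a_(2k+2) = act (2k+1)
--   prop k = p_(k+1) ↦ (a_(2k+3))^⊤ = (act (2k+2))^⊤
translate : E → E
translate (act k)  = act (suc (2 * k))
translate (prop k) = act (suc (suc (2 * k))) ⊤
translate 𝟘 = 𝟘
translate 𝟙 = 𝟙
translate (e ⊕ f) = translate e ⊕ translate f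
translate (e ⊙ f) = translate e ⊙ translate f
translate (e ⊥) = translate e ⊥
translate (e ⊤) = translate e ⊤
translate (e ⋆) = translate e ⋆

-- The translation is a substitution of letters by expressions. Every axiom
-- is stable under substituting expressions for letters, except p^⊤ ≡ p, which
-- survives precisely when each letter p is sent to a test, i.e. an x with
-- x^⊤ ≡ x; and a^⊤ is a test because x^⊥⊥⊥ ≡ x^⊥ in every antidomain
-- algebra.  Hence the translation preserves ≡.  Conversely, the substitution
-- that decodes a_(2n) back to a_n and a_(2n+1) to p_n is again
-- test-preserving, and it undoes the translation up to p^⊤ ≡ p; so it
-- reflects ≡ back.
module Submission where

open import Defs
open import Data.Nat using (ℕ; zero; suc; _*_)
open import Data.Nat.Properties using (*-suc)
open import Data.Product using (_×_; _,_)
open import Relation.Binary.Bundles using (Setoid)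
open import Relation.Binary.PropositionalEquality
  using (_≡_; refl; cong; cong₂; trans; sym; subst₂)

≡ₑ-setoid : Setoid _ _
≡ₑ-setoid = record
  { Carrier       = E
  ; _≈_           = _≡ₑ_
  ; isEquivalence = record { refl = refl≡ ; sym = sym≡ ; trans = trans≡ }
  }

open Setoid ≡ₑ-setoid using (reflexive)
open import Relation.Binary.Reasoning.Setoid ≡ₑ-setoid

⊕-idˡ : ∀ {e} → 𝟘 ⊕ e ≡ₑ e
⊕-idˡ = trans≡ ⊕-comm ⊕-idʳ

≦-antisym : ∀ {e f} → e ≦ f → f ≦ e → e ≡ₑ f
≦-antisym {e} {f} e≦f f≦e = begin
  e      ≈⟨ f≦e ⟨
  f ⊕ e  ≈⟨ ⊕-comm ⟩
  e ⊕ f  ≈⟨ e≦f ⟩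
  f      ∎

⊥-compl : ∀ {e} → e ⊥ ⊕ e ⊥ ⊥ ≡ₑ 𝟙
⊥-compl = trans≡ (cong⊕ refl≡ (sym≡ ⊤-def)) ⊥⊤-compl

⊥⊥-⊙-idˡ : ∀ {e} → e ⊥ ⊥ ⊙ e ≡ₑ e
⊥⊥-⊙-idˡ {e} = begin
  e ⊥ ⊥ ⊙ e                ≈⟨ ⊕-idˡ ⟨
  𝟘 ⊕ e ⊥ ⊥ ⊙ e            ≈⟨ cong⊕ ⊥-ann refl≡ ⟨
  e ⊥ ⊙ e ⊕ e ⊥ ⊥ ⊙ e      ≈⟨ distribʳ ⟨
  (e ⊥ ⊕ e ⊥ ⊥) ⊙ e        ≈⟨ cong⊙ ⊥-compl refl≡ ⟩
  𝟙 ⊙ e                    ≈⟨ ⊙-idˡ ⟩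
  e                        ∎

𝟙⊥≡𝟘 : 𝟙 ⊥ ≡ₑ 𝟘
𝟙⊥≡𝟘 = trans≡ (sym≡ ⊙-idʳ) ⊥-ann

𝟘⊥≡𝟙 : 𝟘 ⊥ ≡ₑ 𝟙
𝟘⊥≡𝟙 = begin
  𝟘 ⊥              ≈⟨ cong⊥ 𝟙⊥≡𝟘 ⟨
  𝟙 ⊥ ⊥            ≈⟨ ⊕-idˡ ⟨
  𝟘 ⊕ 𝟙 ⊥ ⊥        ≈⟨ cong⊕ 𝟙⊥≡𝟘 refl≡ ⟨
  𝟙 ⊥ ⊕ 𝟙 ⊥ ⊥      ≈⟨ ⊥-compl ⟩
  𝟙                ∎

⊥≡𝟙⇒≡𝟘 : ∀ {e} → e ⊥ ≡ₑ 𝟙 → e ≡ₑ 𝟘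
⊥≡𝟙⇒≡𝟘 {e} e⊥≡𝟙 = begin
  e          ≈⟨ ⊥⊥-⊙-idˡ ⟨
  e ⊥ ⊥ ⊙ e  ≈⟨ cong⊙ (trans≡ (cong⊥ e⊥≡𝟙) 𝟙⊥≡𝟘) refl≡ ⟩
  𝟘 ⊙ e      ≈⟨ ⊙-zeroˡ ⟩
  𝟘          ∎

⊙≡𝟘⇒⊙⊥⊥≡𝟘 : ∀ {e f} → e ⊙ f ≡ₑ 𝟘 → e ⊙ f ⊥ ⊥ ≡ₑ 𝟘
⊙≡𝟘⇒⊙⊥⊥≡𝟘 {e} {f} ef≡𝟘 = ⊥≡𝟙⇒≡𝟘 (begin
  (e ⊙ f ⊥ ⊥) ⊥  ≈⟨ cong⊥ (cong⊙ refl≡ ⊤-def) ⟨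
  (e ⊙ f ⊤) ⊥    ≈⟨ ⊥-loc ⟨
  (e ⊙ f) ⊥      ≈⟨ cong⊥ ef≡𝟘 ⟩
  𝟘 ⊥            ≈⟨ 𝟘⊥≡𝟙 ⟩
  𝟙              ∎)

⊥≦𝟙 : ∀ {e} → e ⊥ ≦ 𝟙
⊥≦𝟙 {e} = begin
  e ⊥ ⊕ 𝟙                  ≈⟨ cong⊕ refl≡ ⊥-compl ⟨
  e ⊥ ⊕ (e ⊥ ⊕ e ⊥ ⊥)      ≈⟨ ⊕-assoc ⟩
  e ⊥ ⊕ e ⊥ ⊕ e ⊥ ⊥        ≈⟨ cong⊕ ⊕-idem refl≡ ⟩
  e ⊥ ⊕ e ⊥ ⊥              ≈⟨ ⊥-compl ⟩
  𝟙                        ∎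

⊥⊙≡𝟘⇒⊥≦⊥ : ∀ {e f} → e ⊥ ⊙ f ≡ₑ 𝟘 → e ⊥ ≦ f ⊥
⊥⊙≡𝟘⇒⊥≦⊥ {e} {f} e⊥f≡𝟘 = begin
  e ⊥ ⊕ f ⊥                ≈⟨ cong⊕ e⊥≡e⊥⊙f⊥ (sym≡ ⊙-idˡ) ⟩
  e ⊥ ⊙ f ⊥ ⊕ 𝟙 ⊙ f ⊥      ≈⟨ distribʳ ⟨
  (e ⊥ ⊕ 𝟙) ⊙ f ⊥          ≈⟨ cong⊙ ⊥≦𝟙 refl≡ ⟩
  𝟙 ⊙ f ⊥                  ≈⟨ ⊙-idˡ ⟩
  f ⊥                      ∎
  where
  e⊥≡e⊥⊙f⊥ : e ⊥ ≡ₑ e ⊥ ⊙ f ⊥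
  e⊥≡e⊥⊙f⊥ = begin
    e ⊥                          ≈⟨ ⊙-idʳ ⟨
    e ⊥ ⊙ 𝟙                      ≈⟨ cong⊙ refl≡ ⊥-compl ⟨
    e ⊥ ⊙ (f ⊥ ⊕ f ⊥ ⊥)          ≈⟨ distribˡ ⟩
    e ⊥ ⊙ f ⊥ ⊕ e ⊥ ⊙ f ⊥ ⊥      ≈⟨ cong⊕ refl≡ (⊙≡𝟘⇒⊙⊥⊥≡𝟘 e⊥f≡𝟘) ⟩
    e ⊥ ⊙ f ⊥ ⊕ 𝟘                ≈⟨ ⊕-idʳ ⟩
    e ⊥ ⊙ f ⊥                    ∎

⊥⊥⊥≡⊥ : ∀ {e} → e ⊥ ⊥ ⊥ ≡ₑ e ⊥
⊥⊥⊥≡⊥ {e} = ≦-antisym (⊥⊙≡𝟘⇒⊥≦⊥ ⊥⊥⊥-⊙-annihilates) (⊥⊙≡𝟘⇒⊥≦⊥ (⊙≡𝟘⇒⊙⊥⊥≡𝟘 ⊥-ann))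
  where
  ⊥⊥⊥-⊙-annihilates : e ⊥ ⊥ ⊥ ⊙ e ≡ₑ 𝟘
  ⊥⊥⊥-⊙-annihilates = begin
    e ⊥ ⊥ ⊥ ⊙ e              ≈⟨ cong⊙ refl≡ ⊥⊥-⊙-idˡ ⟨
    e ⊥ ⊥ ⊥ ⊙ (e ⊥ ⊥ ⊙ e)    ≈⟨ ⊙-assoc ⟩
    e ⊥ ⊥ ⊥ ⊙ e ⊥ ⊥ ⊙ e      ≈⟨ cong⊙ ⊥-ann refl≡ ⟩
    𝟘 ⊙ e                    ≈⟨ ⊙-zeroˡ ⟩
    𝟘                        ∎

⊤-idem : ∀ {e} → e ⊤ ⊤ ≡ₑ e ⊤
⊤-idem {e} = begin
  e ⊤ ⊤      ≈⟨ ⊤-def ⟩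
  e ⊤ ⊥ ⊥    ≈⟨ cong⊥ (cong⊥ ⊤-def) ⟩
  e ⊥ ⊥ ⊥ ⊥  ≈⟨ cong⊥ ⊥⊥⊥≡⊥ ⟩
  e ⊥ ⊥      ≈⟨ ⊤-def ⟨
  e ⊤        ∎

module _ (α π : ℕ → E) where

  substitute : E → E
  substitute (act n)  = α n
  substitute (prop n) = π n
  substitute 𝟘        = 𝟘
  substitute 𝟙        = 𝟙
  substitute (e ⊕ f)  = substitute e ⊕ substitute f
  substitute (e ⊙ f)  = substitute e ⊙ substitute f
  substitute (e ⊥)    = substitute e ⊥
  substitute (e ⊤)    = substitute e ⊤
  substitute (e ⋆)    = substitute e ⋆

  substitute-cong : (∀ n → π n ⊤ ≡ₑ π n) →
                    ∀ {e f} → e ≡ₑ f → substitute e ≡ₑ substitute f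
  substitute-cong π-test = go
    where
    go : ∀ {e f} → e ≡ₑ f → substitute e ≡ₑ substitute f
    go refl≡           = refl≡
    go (sym≡ p)        = sym≡ (go p)
    go (trans≡ p q)    = trans≡ (go p) (go q)
    go (cong⊕ p q)     = cong⊕ (go p) (go q)
    go (cong⊙ p q)     = cong⊙ (go p) (go q)
    go (cong⊥ p)       = cong⊥ (go p)
    go (cong⊤ p)       = cong⊤ (go p)
    go (cong⋆ p)       = cong⋆ (go p)
    go ⊕-assoc         = ⊕-assoc
    go ⊕-comm          = ⊕-comm
    go ⊕-idem          = ⊕-idem
    go ⊕-idʳ           = ⊕-idʳ
    go ⊙-assoc         = ⊙-assoc
    go ⊙-idˡ           = ⊙-idˡ
    go ⊙-idʳ           = ⊙-idʳ
    go ⊙-zeroˡ         = ⊙-zeroˡ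
    go ⊙-zeroʳ         = ⊙-zeroʳ
    go distribˡ        = distribˡ
    go distribʳ        = distribʳ
    go star-unfoldˡ    = star-unfoldˡ
    go star-unfoldʳ    = star-unfoldʳ
    go (star-indˡ p)   = star-indˡ (go p)
    go (star-indʳ p)   = star-indʳ (go p)
    go ⊥-ann           = ⊥-ann
    go ⊥-loc           = ⊥-loc
    go ⊥⊤-compl        = ⊥⊤-compl
    go (prop-⊤ {n})    = π-test n
    go ⊤-def           = ⊤-def

encodeAct encodeProp : ℕ → E
encodeAct  k = act (suc (2 * k))
encodeProp k = act (suc (suc (2 * k))) ⊤

translate≡substitute : ∀ e → translate e ≡ substitute encodeAct encodeProp e
translate≡substitute (act k)  = refl
translate≡substitute (prop k) = refl
translate≡substitute 𝟘        = refl
translate≡substitute 𝟙        = refl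
translate≡substitute (e ⊕ f)  = cong₂ _⊕_ (translate≡substitute e) (translate≡substitute f)
translate≡substitute (e ⊙ f)  = cong₂ _⊙_ (translate≡substitute e) (translate≡substitute f)
translate≡substitute (e ⊥)    = cong _⊥ (translate≡substitute e)
translate≡substitute (e ⊤)    = cong _⊤ (translate≡substitute e)
translate≡substitute (e ⋆)    = cong _⋆ (translate≡substitute e)

translate-cong : ∀ {e f} → e ≡ₑ f → translate e ≡ₑ translate f
translate-cong {e} {f} e≡f =
  subst₂ _≡ₑ_ (sym (translate≡substitute e)) (sym (translate≡substitute f))
         (substitute-cong encodeAct encodeProp (λ _ → ⊤-idem) e≡f)

nextLetter : E → E
nextLetter (act n)  = act (suc n)
nextLetter (prop n) = prop (suc n)
nextLetter e        = e

decode : ℕ → E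
decode zero          = act zero
decode (suc zero)    = prop zero
decode (suc (suc n)) = nextLetter (decode n)

decode-even : ∀ k → decode (2 * k) ≡ act k
decode-even zero    = refl
decode-even (suc k) = trans (cong decode (*-suc 2 k)) (cong nextLetter (decode-even k))

decode-odd : ∀ k → decode (suc (2 * k)) ≡ prop k
decode-odd zero    = refl
decode-odd (suc k) = trans (cong (λ n → decode (suc n)) (*-suc 2 k)) (cong nextLetter (decode-odd k))

-- a_1 lies outside the image of the translation, so it may go anywhere.
decodeAct : ℕ → E
decodeAct zero    = 𝟘
decodeAct (suc n) = decode n

decode-translate : ∀ e → substitute decodeAct prop (translate e) ≡ₑ e
decode-translate (act k)  = reflexive (decode-even k)
decode-translate (prop k) = trans≡ (cong⊤ (reflexive (decode-odd k))) prop-⊤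
decode-translate 𝟘        = refl≡
decode-translate 𝟙        = refl≡
decode-translate (e ⊕ f)  = cong⊕ (decode-translate e) (decode-translate f)
decode-translate (e ⊙ f)  = cong⊙ (decode-translate e) (decode-translate f)
decode-translate (e ⊥)    = cong⊥ (decode-translate e)
decode-translate (e ⊤)    = cong⊤ (decode-translate e)
decode-translate (e ⋆)    = cong⋆ (decode-translate e)

translate-reflects : ∀ {e f} → translate e ≡ₑ translate f → e ≡ₑ f
translate-reflects {e} {f} te≡tf = begin
  e                                         ≈⟨ decode-translate e ⟨
  substitute decodeAct prop (translate e)   ≈⟨ substitute-cong decodeAct prop (λ _ → prop-⊤) te≡tf ⟩
  substitute decodeAct prop (translate f)   ≈⟨ decode-translate f ⟩
  f                                         ∎

lemma10 : ∀ (e f : E) → ((e ≡ₑ f → translate e ≡ₑ translate f) × (translate e ≡ₑ translate f → e ≡ₑ f))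
lemma10 e f = translate-cong , translate-reflects
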